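{- Let $\mathbb{A}$ be a nonnegative tensor of order $m$ and dimension $n$, and let $t$ be a positive integer. Then $\mathbb{A}$ is strongly primitive if and only if $\mathbb{A}^t$ is strongly primitive.
   Context: General product: for $\mathbb{A}=(a_{i_1\ldots i_m})$ of order $m\ge2$ and $\mathbb{B}$ of order $k\ge1$, both of dimension $n$, $\mathbb{A}\mathbb{B}$ is the order $(m-1)(k-1)+1$, dimension $n$ tensor with $(\mathbb{A}\mathbb{B})_{i\alpha_1\ldots\alpha_{m-1}}=\sum_{i_2,\ldots,i_m=1}^n a_{ii_2\ldots i_m}b_{i_2\alpha_1}\cdots b_{i_m\alpha_{m-1}}$ ($i\in[n]$, $\alpha_j\in[n]^{k-1}$). It is associative; $\mathbb{A}^1=\mathbb{A}$, $\mathbb{A}^k=\mathbb{A}\mathbb{A}^{k-1}$ (so $\mathbb{A}^t$ is a nonnegative tensor of order $(m-1)^t+1$ and dimension $n$, and $(\mathbb{A}^t)^s=\mathbb{A}^{st}$). A nonnegative tensor $\mathbb{A}$ is strongly primitive if $\mathbb{A}^k$ is positive (all entries $>0$) for some positive integer $k$.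
   Formalization: The nonnegative tensor $\mathbb{A}$ has rational entries. -}

module Defs where

open import Data.Nat using (ℕ; zero; suc; _^_) renaming (_*_ to _*ℕ_; _≤_ to _≤ℕ_)
open import Data.Nat.Properties using (*-identityʳ)
open import Data.Fin using (Fin; zero; suc)
open import Data.Vec using (Vec; []; _∷_; splitAt; cast)
open import Data.Product using (Σ; ∃; ∃-syntax; proj₁; proj₂)
open import Data.Rational using (ℚ; 0ℚ; 1ℚ; _+_; _*_; _≤_; _<_)
open import Relation.Binary.PropositionalEquality using (cong)

Tensor : ℕ → ℕ → Set
Tensor n m = Vec (Fin n) m → ℚ

Nonnegative : ∀ {n m} → Tensor n m → Set
Nonnegative T = ∀ ix → 0ℚ ≤ T ix

Positive : ∀ {n m} → Tensor n m → Set
Positive T = ∀ ix → 0ℚ < T ix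

sumFin : ∀ n → (Fin n → ℚ) → ℚ
sumFin zero    f = 0ℚ
sumFin (suc n) f = f zero + sumFin n (λ i → f (suc i))

sumVec : ∀ n p → (Vec (Fin n) p → ℚ) → ℚ
sumVec n zero    f = f []
sumVec n (suc p) f = sumFin n (λ i → sumVec n p (λ v → f (i ∷ v)))

blocks : ∀ {A : Set} p q → Vec A (p *ℕ q) → Vec (Vec A q) p
blocks zero    q xs = []
blocks (suc p) q xs = proj₁ (splitAt q xs) ∷ blocks p q (proj₁ (proj₂ (splitAt q xs)))

prodB : ∀ {n q} p → Tensor n (suc q) → Vec (Fin n) p → Vec (Vec (Fin n) q) p → ℚ
prodB zero    B []       []       = 1ℚ
prodB (suc p) B (j ∷ js) (α ∷ αs) = B (j ∷ α) * prodB p B js αs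

-- General product: A of order m = suc p, B of order k = suc q;
-- AB has order (m-1)(k-1)+1 = suc (p * q) and
-- (AB)_{i α₁ … α_p} = Σ_{j ∈ [n]^p} a_{i j₁ … j_p} b_{j₁ α₁} ⋯ b_{j_p α_p}.
_⊙_ : ∀ {n p q} → Tensor n (suc p) → Tensor n (suc q) → Tensor n (suc (p *ℕ q))
_⊙_ {n} {p} {q} A B (i ∷ α) =
  sumVec n p (λ j → A (i ∷ j) * prodB p B j (blocks p q α))

-- pow A t = A^(t+1), a tensor of order (m-1)^(t+1)+1.
-- A^1 = A,  A^(k+1) = A A^k.
pow : ∀ {n p} → Tensor n (suc p) → (t : ℕ) → Tensor n (suc (p ^ suc t))
pow {n} {p} A zero    ix = A (cast (cong suc (*-identityʳ p)) ix)
pow {n} {p} A (suc t) = A ⊙ pow A t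

StronglyPrimitive : ∀ {n p} → Tensor n (suc p) → Set
StronglyPrimitive A = ∃[ s ] Positive (pow A s)

{-# OPTIONS --safe #-}
module Submission where

-- Only the zero pattern of the powers of A matters. Read the support of a tensor of
-- order q + 1 as a relation between a first index and the word of its other q indices.
-- Since (A B)_{iα} > 0 exactly when some j has a_{ij} > 0 and b_{j_r α_r} > 0 for all r,
-- the support of A B is the composite of the supports, so the support of A^k is the k-fold
-- composite of that of A, and (A^t)^j has the same support as A^{tj}. Moreover, once some
-- A^k is positive every slice of A has a positive entry, which makes A^{k+1} = A A^k
-- positive as well; so A^k positive gives A^{tk} = (A^t)^k positive.

open import Data.Empty using (⊥-elim)
open import Data.Fin using (Fin; zero; suc)
open import Data.List using (List; []; _∷_; _++_; [_])
import Data.List.Properties as List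
import Data.Nat as ℕ
open ℕ using (ℕ; zero; suc; _+_; _*_; _^_; _≤′_; ≤′-refl; ≤′-step)
import Data.Nat.Properties as ℕ
open import Data.Product using (∃-syntax; Σ-syntax; ∃₂; _×_; _,_)
import Data.Product.Function.Dependent.Propositional as Σ
open import Data.Product.Function.NonDependent.Propositional using (_×-cong_)
import Data.Rational as ℚ
open ℚ using (ℚ; 0ℚ; 1ℚ; _≤_; _<_)
import Data.Rational.Properties as ℚ
open import Data.Sum using (_⊎_; inj₁; inj₂)
open import Data.Vec as Vec using (Vec; []; _∷_; toList; concat; cast; replicate; splitAt)
import Data.Vec.Properties as Vec
open import Data.Vec.Relation.Binary.Pointwise.Inductive as Pointwise
  using (Pointwise; []; _∷_)
open import Function using (_∘_)
open import Function.Bundles using (_⇔_; mk⇔; module Equivalence)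
open Equivalence using (to; from)
import Function.Properties.Equivalence as ⇔
open import Function.Related.Propositional using (module EquationalReasoning)
open EquationalReasoning
open import Relation.Binary.Core using (_⇒_) renaming (_⇔_ to _≐_)
open import Relation.Binary.PropositionalEquality
  using (_≡_; _≢_; refl; sym; trans; cong; subst)
open import Relation.Nullary using (yes; no)

open import Defs

variable
  n p q : ℕ
  a b : ℚ

≥0∧≢0⇒>0 : 0ℚ ≤ a → a ≢ 0ℚ → 0ℚ < a
≥0∧≢0⇒>0 {a} 0≤a a≢0 with 0ℚ ℚ.<? a
... | yes 0<a = 0<a
... | no 0≮a = ⊥-elim (a≢0 (ℚ.≤-antisym (ℚ.≮⇒≥ 0≮a) 0≤a))

*-pos : 0ℚ < a → 0ℚ < b → 0ℚ < a ℚ.* b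
*-pos {a} {b} 0<a 0<b =
  subst (_< a ℚ.* b) (ℚ.*-zeroˡ b) (ℚ.*-monoˡ-<-pos b {{ℚ.positive 0<b}} 0<a)

*-nonneg : 0ℚ ≤ a → 0ℚ ≤ b → 0ℚ ≤ a ℚ.* b
*-nonneg {a} {b} 0≤a 0≤b =
  subst (_≤ a ℚ.* b) (ℚ.*-zeroʳ a) (ℚ.*-monoˡ-≤-nonNeg a {{ℚ.nonNegative 0≤a}} 0≤b)

module _ (0≤a : 0ℚ ≤ a) (0≤b : 0ℚ ≤ b) where

  +-pos⇔ : 0ℚ < a ℚ.+ b ⇔ (0ℚ < a ⊎ 0ℚ < b)
  +-pos⇔ = mk⇔ split join
    where
    split : 0ℚ < a ℚ.+ b → 0ℚ < a ⊎ 0ℚ < b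
    split 0<a+b with 0ℚ ℚ.<? a | 0ℚ ℚ.<? b
    ... | yes 0<a | _       = inj₁ 0<a
    ... | no _    | yes 0<b = inj₂ 0<b
    ... | no 0≮a  | no 0≮b  = ⊥-elim (ℚ.<-irrefl refl (ℚ.<-≤-trans 0<a+b a+b≤0))
      where a+b≤0 = ℚ.+-mono-≤ (ℚ.≮⇒≥ 0≮a) (ℚ.≮⇒≥ 0≮b)
    join : 0ℚ < a ⊎ 0ℚ < b → 0ℚ < a ℚ.+ b
    join (inj₁ 0<a) = ℚ.+-mono-<-≤ 0<a 0≤b
    join (inj₂ 0<b) = ℚ.+-mono-≤-< 0≤a 0<b

  *-pos⇔ : 0ℚ < a ℚ.* b ⇔ (0ℚ < a × 0ℚ < b)
  *-pos⇔ = mk⇔ split (λ (0<a , 0<b) → *-pos 0<a 0<b)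
    where
    split : 0ℚ < a ℚ.* b → 0ℚ < a × 0ℚ < b
    split 0<ab =
      ≥0∧≢0⇒>0 0≤a (λ { refl → ℚ.<-irrefl (sym (ℚ.*-zeroˡ b)) 0<ab }) ,
      ≥0∧≢0⇒>0 0≤b (λ { refl → ℚ.<-irrefl (sym (ℚ.*-zeroʳ a)) 0<ab })

sumFin-nonneg : ∀ n {f : Fin n → ℚ} → (∀ i → 0ℚ ≤ f i) → 0ℚ ≤ sumFin n f
sumFin-nonneg zero    f≥0 = ℚ.≤-refl
sumFin-nonneg (suc n) f≥0 = ℚ.+-mono-≤ (f≥0 zero) (sumFin-nonneg n (f≥0 ∘ suc))

sumFin-pos⇔ : ∀ n {f : Fin n → ℚ} → (∀ i → 0ℚ ≤ f i) →
              0ℚ < sumFin n f ⇔ (∃[ i ] 0ℚ < f i)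
sumFin-pos⇔ zero    f≥0 = mk⇔ (λ 0<0 → ⊥-elim (ℚ.<-irrefl refl 0<0)) λ ()
sumFin-pos⇔ (suc n) {f} f≥0 = mk⇔ split join
  where
  head+tail = +-pos⇔ (f≥0 zero) (sumFin-nonneg n (f≥0 ∘ suc))
  tail = sumFin-pos⇔ n (f≥0 ∘ suc)
  split : 0ℚ < sumFin (suc n) f → ∃[ i ] 0ℚ < f i
  split 0<Σ with to head+tail 0<Σ
  ... | inj₁ 0<f₀ = zero , 0<f₀
  ... | inj₂ 0<Σ′ = let i , 0<fᵢ = to tail 0<Σ′ in suc i , 0<fᵢ
  join : ∃[ i ] 0ℚ < f i → 0ℚ < sumFin (suc n) f
  join (zero  , 0<f₀) = from head+tail (inj₁ 0<f₀)
  join (suc i , 0<fᵢ) = from head+tail (inj₂ (from tail (i , 0<fᵢ)))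

sumVec-nonneg : ∀ n p {f : Vec (Fin n) p → ℚ} → (∀ v → 0ℚ ≤ f v) → 0ℚ ≤ sumVec n p f
sumVec-nonneg n zero    f≥0 = f≥0 []
sumVec-nonneg n (suc p) f≥0 = sumFin-nonneg n (λ i → sumVec-nonneg n p (f≥0 ∘ (i ∷_)))

sumVec-pos⇔ : ∀ n p {f : Vec (Fin n) p → ℚ} → (∀ v → 0ℚ ≤ f v) →
              0ℚ < sumVec n p f ⇔ (∃[ v ] 0ℚ < f v)
sumVec-pos⇔ n zero    f≥0 = mk⇔ ([] ,_) λ { ([] , 0<f) → 0<f }
sumVec-pos⇔ n (suc p) {f} f≥0 = mk⇔ split join
  where
  heads = sumFin-pos⇔ n (λ i → sumVec-nonneg n p (f≥0 ∘ (i ∷_)))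
  tails = λ i → sumVec-pos⇔ n p (f≥0 ∘ (i ∷_))
  split : 0ℚ < sumVec n (suc p) f → ∃[ v ] 0ℚ < f v
  split 0<Σ = let i , 0<Σᵢ = to heads 0<Σ
                  v , 0<f  = to (tails i) 0<Σᵢ
              in i ∷ v , 0<f
  join : ∃[ v ] 0ℚ < f v → 0ℚ < sumVec n (suc p) f
  join (i ∷ v , 0<f) = from heads (i , from (tails i) (v , 0<f))

PositiveAt : Tensor n (suc q) → Fin n → Vec (Fin n) q → Set
PositiveAt B j β = 0ℚ < B (j ∷ β)

module _ {B : Tensor n (suc q)} (B≥0 : Nonnegative B) where

  prodB-nonneg : ∀ p js βs → 0ℚ ≤ prodB p B js βs
  prodB-nonneg zero    []       []       = ℚ.<⇒≤ (ℚ.positive⁻¹ 1ℚ)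
  prodB-nonneg (suc p) (j ∷ js) (β ∷ βs) = *-nonneg (B≥0 _) (prodB-nonneg p js βs)

  prodB-pos⇔ : ∀ p js βs → 0ℚ < prodB p B js βs ⇔ Pointwise (PositiveAt B) js βs
  prodB-pos⇔ zero    []       []       = mk⇔ (λ _ → []) (λ _ → ℚ.positive⁻¹ 1ℚ)
  prodB-pos⇔ (suc p) (j ∷ js) (β ∷ βs) = begin
    0ℚ < B (j ∷ β) ℚ.* prodB p B js βs
      ∼⟨ *-pos⇔ (B≥0 _) (prodB-nonneg p js βs) ⟩
    (0ℚ < B (j ∷ β) × 0ℚ < prodB p B js βs)
      ∼⟨ ⇔.refl ×-cong prodB-pos⇔ p js βs ⟩
    (PositiveAt B j β × Pointwise (PositiveAt B) js βs)
      ∼⟨ mk⇔ (λ (h , hs) → h ∷ hs) Pointwise.uncons ⟩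
    Pointwise (PositiveAt B) (j ∷ js) (β ∷ βs)
      ∎

module _ {A : Tensor n (suc p)} {B : Tensor n (suc q)}
         (A≥0 : Nonnegative A) (B≥0 : Nonnegative B) where

  private
    term≥0 : ∀ i α j → 0ℚ ≤ A (i ∷ j) ℚ.* prodB p B j (blocks p q α)
    term≥0 i α j = *-nonneg (A≥0 _) (prodB-nonneg B≥0 p j _)

  ⊙-nonneg : Nonnegative (A ⊙ B)
  ⊙-nonneg (i ∷ α) = sumVec-nonneg n p (term≥0 i α)

  ⊙-pos⇔ : ∀ i α → 0ℚ < (A ⊙ B) (i ∷ α) ⇔
           (∃[ j ] 0ℚ < A (i ∷ j) × Pointwise (PositiveAt B) j (blocks p q α))
  ⊙-pos⇔ i α = begin
    0ℚ < (A ⊙ B) (i ∷ α)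
      ∼⟨ sumVec-pos⇔ n p (term≥0 i α) ⟩
    (∃[ j ] 0ℚ < A (i ∷ j) ℚ.* prodB p B j (blocks p q α))
      ∼⟨ Σ.congˡ (*-pos⇔ (A≥0 _) (prodB-nonneg B≥0 p _ _)) ⟩
    (∃[ j ] 0ℚ < A (i ∷ j) × 0ℚ < prodB p B j (blocks p q α))
      ∼⟨ Σ.congˡ (⇔.refl ×-cong prodB-pos⇔ B≥0 p _ _) ⟩
    (∃[ j ] 0ℚ < A (i ∷ j) × Pointwise (PositiveAt B) j (blocks p q α))
      ∎

pow-nonneg : {A : Tensor n (suc p)} → Nonnegative A → ∀ k → Nonnegative (pow A k)
pow-nonneg A≥0 zero    (i ∷ α) = A≥0 _
pow-nonneg A≥0 (suc k) = ⊙-nonneg A≥0 (pow-nonneg A≥0 k)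

concat-blocks : ∀ {X : Set} p q (xs : Vec X (p * q)) → concat (blocks p q xs) ≡ xs
concat-blocks zero    q [] = refl
concat-blocks (suc p) q xs with splitAt q xs
... | ys , zs , refl = cong (ys Vec.++_) (concat-blocks p q zs)

blocks-concat : ∀ {X : Set} p q (xss : Vec (Vec X q) p) → blocks p q (concat xss) ≡ xss
blocks-concat zero    q []         = refl
blocks-concat (suc p) q (xs ∷ xss) with splitAt q (xs Vec.++ concat xss)
... | ys , zs , eq with Vec.++-injective xs ys eq
...   | refl , refl = cong (xs ∷_) (blocks-concat p q xss)

-- Words are lists rather than vectors, so that composing supports involves no arithmetic
-- on lengths; the length of the words only comes back in Full.
Substitution : ℕ → Set₁
Substitution n = Fin n → List (Fin n) → Set

module _ {n : ℕ} where

  infixr 9 _⨾_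

  data Parallel (R : Substitution n) : List (Fin n) → List (Fin n) → Set where
    []  : Parallel R [] []
    _∷_ : ∀ {i is ls ls′} → R i ls → Parallel R is ls′ →
          Parallel R (i ∷ is) (ls ++ ls′)

  Idₛ : Substitution n
  Idₛ i ls = ls ≡ [ i ]

  _⨾_ : Substitution n → Substitution n → Substitution n
  (R ⨾ Q) i ls = ∃[ ms ] R i ms × Parallel Q ms ls

  _^[_] : Substitution n → ℕ → Substitution n
  R ^[ zero ]  = Idₛ
  R ^[ suc k ] = R ⨾ R ^[ k ]

  variable
    R R′ Q Q′ P : Substitution n
    is js ls ls′ ms : List (Fin n)

  ≐-refl : R ≐ R
  ≐-refl = (λ r → r) , (λ r → r)

  ≐-sym : R ≐ Q → Q ≐ R
  ≐-sym (R⇒Q , Q⇒R) = Q⇒R , R⇒Q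

  ≐-trans : R ≐ Q → Q ≐ P → R ≐ P
  ≐-trans (R⇒Q , Q⇒R) (Q⇒P , P⇒Q) = (λ r → Q⇒P (R⇒Q r)) , (λ p → Q⇒R (P⇒Q p))

  Parallel-map : R ⇒ Q → Parallel R ⇒ Parallel Q
  Parallel-map R⇒Q []       = []
  Parallel-map R⇒Q (r ∷ rs) = R⇒Q r ∷ Parallel-map R⇒Q rs

  Parallel-++⁺ : Parallel R is ls → Parallel R js ls′ →
                 Parallel R (is ++ js) (ls ++ ls′)
  Parallel-++⁺ []                      rs′ = rs′
  Parallel-++⁺ (_∷_ {ls = l} {ls′ = ls} r rs) rs′ =
    subst (Parallel _ _) (sym (List.++-assoc l ls _)) (r ∷ Parallel-++⁺ rs rs′)

  Parallel-++⁻ : ∀ is → Parallel R (is ++ js) ls →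
                 ∃₂ λ l l′ → ls ≡ l ++ l′ × Parallel R is l × Parallel R js l′
  Parallel-++⁻ []       rs = [] , _ , refl , [] , rs
  Parallel-++⁻ (i ∷ is) (_∷_ {ls = l₀} r rs) with Parallel-++⁻ is rs
  ... | l , l′ , refl , rsˡ , rsʳ =
    l₀ ++ l , l′ , sym (List.++-assoc l₀ l l′) , r ∷ rsˡ , rsʳ

  Parallel-singleton : ∀ {i} → R i ls ⇔ Parallel R [ i ] ls
  Parallel-singleton {R = R} {ls} {i} = mk⇔
    (λ r → subst (Parallel R [ i ]) (List.++-identityʳ ls) (r ∷ []))
    (λ { (_∷_ {ls = l} r []) → subst (R i) (sym (List.++-identityʳ l)) r })

  Parallel-Idₛ : Parallel Idₛ is ls ⇔ ls ≡ is
  Parallel-Idₛ = mk⇔ collapse (λ { refl → diagonal _ })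
    where
    collapse : Parallel Idₛ is ls → ls ≡ is
    collapse []         = refl
    collapse (refl ∷ r) = cong (_ ∷_) (collapse r)
    diagonal : ∀ is → Parallel Idₛ is is
    diagonal []       = []
    diagonal (i ∷ is) = refl ∷ diagonal is

  Parallel-⨾⁺ : Parallel R is ms → Parallel Q ms ls → Parallel (R ⨾ Q) is ls
  Parallel-⨾⁺ [] [] = []
  Parallel-⨾⁺ (_∷_ {ls = ms} r rs) qs with Parallel-++⁻ ms qs
  ... | _ , _ , refl , qsˡ , qsʳ = (ms , r , qsˡ) ∷ Parallel-⨾⁺ rs qsʳ

  Parallel-⨾⁻ : Parallel (R ⨾ Q) is ls → ∃[ ms ] Parallel R is ms × Parallel Q ms ls
  Parallel-⨾⁻ [] = [] , [] , []
  Parallel-⨾⁻ ((ms , r , qs) ∷ rqs) =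
    let ms′ , rs , qs′ = Parallel-⨾⁻ rqs in ms ++ ms′ , r ∷ rs , Parallel-++⁺ qs qs′

  ⨾-cong : R ≐ R′ → Q ≐ Q′ → R ⨾ Q ≐ R′ ⨾ Q′
  ⨾-cong (R⇒R′ , R′⇒R) (Q⇒Q′ , Q′⇒Q) =
    (λ (ms , r , qs) → ms , R⇒R′ r , Parallel-map Q⇒Q′ qs) ,
    (λ (ms , r , qs) → ms , R′⇒R r , Parallel-map Q′⇒Q qs)

  ⨾-identityˡ : Idₛ ⨾ R ≐ R
  ⨾-identityˡ = (λ { (_ , refl , rs) → from Parallel-singleton rs }) ,
                (λ r → _ , refl , to Parallel-singleton r)

  ⨾-identityʳ : R ⨾ Idₛ ≐ R
  ⨾-identityʳ {R = R} =
    (λ { {i} (ms , r , ids) → subst (R i) (sym (to Parallel-Idₛ ids)) r }) ,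
    (λ r → _ , r , from Parallel-Idₛ refl)

  ⨾-assoc : (R ⨾ Q) ⨾ P ≐ R ⨾ (Q ⨾ P)
  ⨾-assoc =
    (λ (ls , (ms , r , qs) , ps) → ms , r , Parallel-⨾⁺ qs ps) ,
    (λ (ms , r , qps) → let ls , qs , ps = Parallel-⨾⁻ qps in ls , (ms , r , qs) , ps)

  ^-cong : ∀ k → R ≐ Q → R ^[ k ] ≐ Q ^[ k ]
  ^-cong zero    R≐Q = ≐-refl
  ^-cong (suc k) R≐Q = ⨾-cong R≐Q (^-cong k R≐Q)

  ^-+ : ∀ a b → R ^[ a + b ] ≐ R ^[ a ] ⨾ R ^[ b ]
  ^-+ zero    b = ≐-sym ⨾-identityˡ
  ^-+ (suc a) b = ≐-trans (⨾-cong ≐-refl (^-+ a b)) (≐-sym ⨾-assoc)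

  ^-* : ∀ s k → (R ^[ s ]) ^[ k ] ≐ R ^[ k * s ]
  ^-* s zero    = ≐-refl
  ^-* s (suc k) = ≐-trans (⨾-cong ≐-refl (^-* s k)) (≐-sym (^-+ s (k * s)))

support : Tensor n (suc q) → Substitution n
support X i ls = ∃[ α ] 0ℚ < X (i ∷ α) × toList α ≡ ls

Full : ℕ → Substitution n → Set
Full {n} q R = ∀ i (α : Vec (Fin n) q) → R i (toList α)

Full-cong : {R Q : Substitution n} → R ≐ Q → Full q R ⇔ Full q Q
Full-cong (R⇒Q , Q⇒R) = mk⇔ (λ full i α → R⇒Q (full i α)) (λ full i α → Q⇒R (full i α))

positive⇔full-support : (X : Tensor n (suc q)) → Positive X ⇔ Full q (support X)
positive⇔full-support X = mk⇔ (λ X>0 i α → α , X>0 (i ∷ α) , refl) positive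
  where
  positive : Full _ (support X) → Positive X
  positive full (i ∷ α) with full i α
  ... | β , 0<X , β≡α =
    subst (λ γ → 0ℚ < X (i ∷ γ))
          (trans (sym (Vec.cast-is-id refl β)) (Vec.toList-injective refl β α β≡α)) 0<X

module _ (B : Tensor n (suc q)) where

  Parallel-support⁺ : {js : Vec (Fin n) p} {βs : Vec (Vec (Fin n) q) p} →
                      Pointwise (PositiveAt B) js βs →
                      Parallel (support B) (toList js) (toList (concat βs))
  Parallel-support⁺ []                    = []
  Parallel-support⁺ {βs = β ∷ βs} (0<B ∷ pw) =
    subst (Parallel _ _) (sym (Vec.toList-++ β (concat βs)))
          ((β , 0<B , refl) ∷ Parallel-support⁺ pw)

  Parallel-support⁻ : (js : Vec (Fin n) p) → Parallel (support B) (toList js) ls →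
                      Σ[ βs ∈ Vec (Vec (Fin n) q) p ]
                        Pointwise (PositiveAt B) js βs × toList (concat βs) ≡ ls
  Parallel-support⁻ []       []                           = [] , [] , refl
  Parallel-support⁻ (j ∷ js) ((β , 0<B , refl) ∷ supports) =
    let βs , pw , eq = Parallel-support⁻ js supports in
    β ∷ βs , 0<B ∷ pw , trans (Vec.toList-++ β (concat βs)) (cong (toList β ++_) eq)

support-⊙ : {A : Tensor n (suc p)} {B : Tensor n (suc q)} → Nonnegative A → Nonnegative B →
            support (A ⊙ B) ≐ support A ⨾ support B
support-⊙ {p = p} {q = q} {A = A} {B} A≥0 B≥0 = split , join
  where
  split : support (A ⊙ B) ⇒ support A ⨾ support B
  split (α , 0<AB , refl) =
    let j , 0<A , pw = to (⊙-pos⇔ A≥0 B≥0 _ α) 0<AB in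
    toList j , (j , 0<A , refl) ,
    subst (Parallel _ _) (cong toList (concat-blocks p q α)) (Parallel-support⁺ B pw)
  join : support A ⨾ support B ⇒ support (A ⊙ B)
  join (_ , (j , 0<A , refl) , supports) =
    let βs , pw , eq = Parallel-support⁻ B j supports in
    concat βs ,
    from (⊙-pos⇔ A≥0 B≥0 _ _) (j , 0<A , subst (Pointwise _ j) (sym (blocks-concat p q βs)) pw) , eq

support-pow-zero : (A : Tensor n (suc p)) → support (pow A 0) ≐ support A
support-pow-zero {p = p} A =
  (λ (α , 0<A , eq) → cast p*1≡p α , 0<A , trans (Vec.toList-cast p*1≡p α) eq) ,
  (λ { {i} (β , 0<A , eq) →
       cast (sym p*1≡p) β ,
       subst (λ γ → 0ℚ < A (i ∷ γ)) (sym (Vec.cast-sym (sym p*1≡p) refl)) 0<A ,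
       trans (Vec.toList-cast (sym p*1≡p) β) eq })
  where p*1≡p = ℕ.*-identityʳ p

support-pow : {A : Tensor n (suc p)} → Nonnegative A →
              ∀ k → support (pow A k) ≐ support A ^[ suc k ]
support-pow {A = A} A≥0 zero    = ≐-trans (support-pow-zero A) (≐-sym ⨾-identityʳ)
support-pow         A≥0 (suc k) =
  ≐-trans (support-⊙ A≥0 (pow-nonneg A≥0 k)) (⨾-cong ≐-refl (support-pow A≥0 k))

positive⇔full-pow : {A : Tensor n (suc p)} → Nonnegative A →
                    ∀ k → Positive (pow A k) ⇔ Full (p ^ suc k) (support A ^[ suc k ])
positive⇔full-pow {A = A} A≥0 k =
  ⇔.trans (positive⇔full-support (pow A k)) (Full-cong (support-pow A≥0 k))

module _ {A : Tensor n (suc p)} (A≥0 : Nonnegative A) where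

  -- pow A k is A^(k+1), so s + j * suc s is the exponent (s + 1)(j + 1) - 1.
  pow-pow-positive⇔ : ∀ s j → Positive (pow (pow A s) j) ⇔ Positive (pow A (s + j * suc s))
  pow-pow-positive⇔ s j = begin
    Positive (pow (pow A s) j)
      ∼⟨ positive⇔full-pow (pow-nonneg A≥0 s) j ⟩
    Full ((p ^ suc s) ^ suc j) (support (pow A s) ^[ suc j ])
      ∼⟨ Full-cong (^-cong (suc j) (support-pow A≥0 s)) ⟩
    Full ((p ^ suc s) ^ suc j) ((support A ^[ suc s ]) ^[ suc j ])
      ∼⟨ Full-cong (^-* (suc s) (suc j)) ⟩
    Full ((p ^ suc s) ^ suc j) (support A ^[ suc j * suc s ])
      ≡⟨ cong (λ q → Full q (support A ^[ suc j * suc s ])) ^-*-assoc′ ⟩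
    Full (p ^ (suc j * suc s)) (support A ^[ suc j * suc s ])
      ∼⟨ ⇔.sym (positive⇔full-pow A≥0 (s + j * suc s)) ⟩
    Positive (pow A (s + j * suc s))
      ∎
    where
    ^-*-assoc′ : (p ^ suc s) ^ suc j ≡ p ^ (suc j * suc s)
    ^-*-assoc′ =
      trans (ℕ.^-*-assoc p (suc s) (suc j)) (cong (p ^_) (ℕ.*-comm (suc s) (suc j)))

  pow-positive⇒row-positive : ∀ k → Positive (pow A k) → ∀ i → ∃[ j ] 0ℚ < A (i ∷ j)
  pow-positive⇒row-positive k A^k>0 i
    with to (positive⇔full-pow A≥0 k) A^k>0 i (replicate _ i)
  ... | _ , (j , 0<A , _) , _ = j , 0<A

  pow-positive-suc : ∀ k → Positive (pow A k) → Positive (pow A (suc k))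
  pow-positive-suc k A^k>0 (i ∷ α) =
    let j , 0<A = pow-positive⇒row-positive k A^k>0 i in
    from (⊙-pos⇔ A≥0 (pow-nonneg A≥0 k) i α) (j , 0<A , everywhere j _)
    where
    everywhere : ∀ {r} (js : Vec (Fin n) r) (βs : Vec _ r) →
                 Pointwise (PositiveAt (pow A k)) js βs
    everywhere []       []       = []
    everywhere (j ∷ js) (β ∷ βs) = A^k>0 (j ∷ β) ∷ everywhere js βs

  pow-positive-mono : ∀ {k l} → k ≤′ l → Positive (pow A k) → Positive (pow A l)
  pow-positive-mono ≤′-refl             = λ A^k>0 → A^k>0
  pow-positive-mono (≤′-step {l} k≤′l) = pow-positive-suc l ∘ pow-positive-mono k≤′l

proposition2p12 : (n p : ℕ) → 1 ℕ.≤ p → (A : Tensor n (suc p)) → Nonnegative A →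
                    (s : ℕ) → StronglyPrimitive A ⇔ StronglyPrimitive (pow A s)
proposition2p12 n p _ A A≥0 s = mk⇔
  (λ (k , A^k>0) → k , from (pow-pow-positive⇔ A≥0 s k)
                            (pow-positive-mono A≥0 (k≤′s+k*[1+s] k) A^k>0))
  (λ (j , positive) → s + j * suc s , to (pow-pow-positive⇔ A≥0 s j) positive)
  where
  k≤′s+k*[1+s] : ∀ k → k ≤′ s + k * suc s
  k≤′s+k*[1+s] k = ℕ.≤⇒≤′ (ℕ.≤-trans (ℕ.m≤m*n k (suc s)) (ℕ.m≤n+m (k * suc s) s))
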